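{- Let $n \ge 1$, $N = 2^n$, and let $f, g : 2^{[n]} \to \mathbb{C}$ be set functions on the subsets of $[n]=\{1,\dots,n\}$. Identify each subset $S \subseteq [n]$ with the integer $\iota(S) = \sum_{j \in S} 2^{j-1} \in \{0,\dots,N-1\}$, so that a set function is a vector of length $N$. Run the following algorithm, in exact arithmetic: (1) For $0 \le i \le n$, form the chopped functions $f^{(i)}, g^{(i)}$, where $f^{(i)}(S) = f(S)$ if $|S| = i$ and $f^{(i)}(S) = 0$ otherwise, and similarly for $g^{(i)}$. Compute their discrete Fourier transforms of length $N$, $\hat f^{(i)} = \mathrm{DFT}(f^{(i)})$ and $\hat g^{(i)} = \mathrm{DFT}(g^{(i)})$. (2) For each $0 \le k \le n$, compute $h^{(k)} = \mathrm{IDFT}\big(\sum_{i=0}^{k} \hat f^{(i)} \cdot \hat g^{(k-i)}\big)$, where $\cdot$ denotes the entrywise product of vectors of length $N$. (3) For each $0 \le k \le n$, set $h^{(k)}(S) := 0$ for every $S \subseteq [n]$ with $|S| \ne k$. (4) Output $h = \sum_{k=0}^{n} h^{(k)}$. Then for every $S \subseteq [n]$, $h(S) = (f \ast g)(S) := \sum_{T \subseteq S} f(T)\, g(S \setminus T)$, i.e., the algorithm correctly computes the subset convolution of $f$ and $g$ in the $(+,\times)$-ring.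
   Context: The discrete Fourier transform of length $N$ of a vector $u = (u_0,\dots,u_{N-1})$ is $\hat u_m = \sum_{t=0}^{N-1} u_t\, \omega^{ -mt}$ for $0 \le m \le N-1$, with $\omega = e^{2\pi \mathrm{i}/N}$; IDFT denotes its inverse, $u_t = \frac{1}{N}\sum_{m=0}^{N-1} \hat u_m\, \omega^{mt}$. In step (2), vectors are indexed by $\{0,\dots,N-1\}$ and the entry of index $\iota(S)$ is the value at $S$; no zero-padding is used. -}

module Defs where

open import Level using (Level)
open import Algebra.Bundles using (CommutativeRing)
open import Data.Bool using (Bool; true; false; if_then_else_)
open import Data.Nat as ℕ using (ℕ; zero; suc; _≡ᵇ_; _∸_; _<_; _≤_; s≤s; z≤n)
open import Data.Nat.DivMod using (_%_; _/_)
open import Data.Nat.Properties as ℕP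
open import Data.Fin using (Fin; toℕ; fromℕ<)
open import Data.Fin.Subset using (Subset; _─_; ∣_∣; inside; outside)
open import Data.Fin.Subset.Properties using (_⊆?_)
open import Data.Vec using ([]; _∷_)
open import Relation.Nullary.Decidable using (does)

-- Binary encoding  ι(S) = Σ_{j ∈ S} 2^(j-1).  The element j ∈ [n] = {1..n}
-- corresponds to position (j-1) : Fin n of the characteristic vector,
-- so position 0 is the least significant bit.
bit : Bool → ℕ
bit true  = 1
bit false = 0

ι : ∀ {n} → Subset n → ℕ
ι []      = 0
ι (b ∷ s) = bit b ℕ.+ 2 ℕ.* ι s

ι<N : ∀ {n} (S : Subset n) → ι S < 2 ℕ.^ n
ι<N []      = s≤s z≤n
ι<N {suc n} (b ∷ s) = begin-strict
    bit b ℕ.+ 2 ℕ.* ι s  <⟨ ℕP.+-monoˡ-< (2 ℕ.* ι s) (lem b) ⟩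
    2 ℕ.+ 2 ℕ.* ι s      ≡⟨ sym (ℕP.*-suc 2 (ι s)) ⟩
    2 ℕ.* suc (ι s)      ≤⟨ ℕP.*-monoʳ-≤ 2 (ι<N s) ⟩
    2 ℕ.* 2 ℕ.^ n        ∎
  where
    open ℕP.≤-Reasoning
    open import Relation.Binary.PropositionalEquality using (sym)
    lem : ∀ b → bit b < 2
    lem true  = s≤s (s≤s z≤n)
    lem false = s≤s z≤n

ιF : ∀ {n} → Subset n → Fin (2 ℕ.^ n)
ιF S = fromℕ< (ι<N S)

bits : (n : ℕ) → ℕ → Subset n
bits zero    t = []
bits (suc n) t = (t % 2 ≡ᵇ 1) ∷ bits n (t / 2)

module SubsetConvolution {c ℓ : Level} (R : CommutativeRing c ℓ) where
  open CommutativeRing R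
  open import Algebra.Definitions.RawMonoid +-rawMonoid using (sum)
  open import Algebra.Bundles using (Semiring)
  open import Algebra.Definitions.RawSemiring (Semiring.rawSemiring semiring) using (_^_)
  open import Algebra.Definitions.RawMonoid +-rawMonoid using (_×_)

  pow : Carrier → ℕ → Carrier
  pow x k = x ^ k

  natCast : ℕ → Carrier
  natCast k = k × 1#

  SetFun : ℕ → Set c
  SetFun n = Subset n → Carrier

  Vector : ℕ → Set c
  Vector N = Fin N → Carrier

  sumSubsets : ∀ {n} → (Subset n → Carrier) → Carrier
  sumSubsets {zero}  F = F []
  sumSubsets {suc n} F = sumSubsets (λ s → F (outside ∷ s)) + sumSubsets (λ s → F (inside ∷ s))

  conv : ∀ {n} → SetFun n → SetFun n → SetFun n
  conv f g S = sumSubsets (λ T → if does (T ⊆? S) then f T * g (S ─ T) else 0#)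

  toVec : ∀ {n} → SetFun n → Vector (2 ℕ.^ n)
  toVec {n} u t = u (bits n (toℕ t))

  fromVec : ∀ {n} → Vector (2 ℕ.^ n) → SetFun n
  fromVec v S = v (ιF S)

  -- DFT of length N with ω̄ = ω⁻¹:  û_m = Σ_t u_t ω^(-m t)
  DFT : ∀ {N} → (ω̄ : Carrier) → Vector N → Vector N
  DFT ω̄ u m = sum (λ t → u t * (ω̄ ^ (toℕ m ℕ.* toℕ t)))

  -- IDFT of length N, with Ninv = 1/N:  u_t = (1/N) Σ_m û_m ω^(m t)
  IDFT : ∀ {N} → (ω Ninv : Carrier) → Vector N → Vector N
  IDFT ω Ninv û t = Ninv * sum (λ m → û m * (ω ^ (toℕ m ℕ.* toℕ t)))

  chop : ∀ {n} → ℕ → SetFun n → SetFun n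
  chop i f S = if ∣ S ∣ ≡ᵇ i then f S else 0#

  algorithm : ∀ {n} → (ω ω̄ Ninv : Carrier) → SetFun n → SetFun n → SetFun n
  algorithm {n} ω ω̄ Ninv f g = h
    where
      f̂ : ℕ → Vector (2 ℕ.^ n)
      f̂ i = DFT ω̄ (toVec (chop i f))
      ĝ : ℕ → Vector (2 ℕ.^ n)
      ĝ i = DFT ω̄ (toVec (chop i g))
      hk : ℕ → SetFun n
      hk k = fromVec (IDFT ω Ninv (λ m → sum {suc k} (λ i → f̂ (toℕ i) m * ĝ (k ∸ toℕ i) m)))
      hk′ : ℕ → SetFun n
      hk′ k = chop k (hk k)
      h : SetFun n
      h S = sum {suc n} (λ k → hk′ (toℕ k) S)

{-# OPTIONS --safe #-}
module Submission where

-- Step (2) computes, by the convolution theorem for the primitive N-th root of unity ω, the sum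
-- of the cyclic convolutions f⁽ⁱ⁾ ⊛ g⁽ᵏ⁻ⁱ⁾, i.e. the sum of f(A) g(B) over the pairs with
-- |A| + |B| = k and ι(A) + ι(B) ≡ ι(S) (mod N). Adding ι(A) and ι(B) in binary, every carry
-- lowers the number of ones of the result by one, so for k = |S| only carry-free additions
-- survive: these are exactly the pairs with A ⊆ S and B = S ∖ A. Steps (3) and (4) then keep,
-- at S, precisely the layer k = |S|, which is the subset convolution.

open import Defs
open import Level using (Level)
open import Algebra.Bundles using (CommutativeRing)
open import Data.Nat as ℕ using (ℕ; _<_; _≤_)
import Data.Nat.Properties as ℕₚ
open import Data.Fin.Subset using (Subset)
open import Data.Sum using (_⊎_)
open import Relation.Nullary using (¬_)
open import Data.Bool using (Bool; true; false; if_then_else_; _∧_)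
open import Data.Bool.Properties using () renaming (_≟_ to _≟ᵇ_)
open import Data.Fin using (Fin; toℕ)
open import Data.Product using (_×_; _,_)
open import Data.Vec using ([]; _∷_)
open import Data.Vec.Properties using (≡-dec)
open import Function using (_⇔_; mk⇔)
open import Relation.Binary.PropositionalEquality as ≡ using (_≡_)
open import Relation.Nullary using (Dec; yes; no; _×-dec_; contradiction)
open import Relation.Nullary.Decidable using (does; dec-true; dec-false; does-⇔)

module Binary where

  open import Data.Nat using (zero; suc; _≡ᵇ_; _+_; _*_; _^_; s≤s; NonZero)
  open import Data.Nat.Properties
  open import Data.Nat.DivMod
    using (_%_; _/_; [m+kn]%n≡m%n; +-distrib-/-∣ʳ; m*n/n≡m; m<n⇒m%n≡m; m≡m%n+[m/n]*n; m%n<n; m<n*o⇒m/o<n)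
  open import Data.Nat.Divisibility using (divides-refl)
  open import Data.Nat.Tactic.RingSolver using (solve-∀)
  open import Data.Bool using (_xor_)
  open import Data.Fin.Subset using (_─_; ∣_∣; _⊆_)
  open import Data.Fin.Subset.Properties using (out⊆; in⊆in; drop-∷-⊆)
  open import Data.Vec using (here)
  open ≡ using (refl; sym; trans; cong; cong₂; subst)

  ∣∷∣ : ∀ {n} b (p : Subset n) → ∣ b ∷ p ∣ ≡ bit b + ∣ p ∣
  ∣∷∣ false p = refl
  ∣∷∣ true  p = refl

  bits-∷ : ∀ n b x → bits (suc n) (bit b + 2 * x) ≡ b ∷ bits n x
  bits-∷ n b x = cong₂ _∷_ lowest-bit (cong (bits n) quotient)
    where
      open ≡.≡-Reasoning
      commute : bit b + 2 * x ≡ bit b + x * 2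
      commute = cong (bit b +_) (*-comm 2 x)
      bit%2 : ∀ b → (bit b % 2 ≡ᵇ 1) ≡ b
      bit%2 false = refl
      bit%2 true  = refl
      bit/2 : ∀ b → bit b / 2 ≡ 0
      bit/2 false = refl
      bit/2 true  = refl
      lowest-bit : ((bit b + 2 * x) % 2 ≡ᵇ 1) ≡ b
      lowest-bit = trans (cong (λ r → r % 2 ≡ᵇ 1) commute)
                         (trans (cong (_≡ᵇ 1) ([m+kn]%n≡m%n (bit b) x 2)) (bit%2 b))
      quotient : (bit b + 2 * x) / 2 ≡ x
      quotient = begin
        (bit b + 2 * x) / 2    ≡⟨ cong (_/ 2) commute ⟩
        (bit b + x * 2) / 2    ≡⟨ +-distrib-/-∣ʳ (bit b) (divides-refl x) ⟩
        bit b / 2 + x * 2 / 2  ≡⟨ cong₂ _+_ (bit/2 b) (m*n/n≡m x 2) ⟩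
        x                      ∎

  bits-ι : ∀ {n} (S : Subset n) → bits n (ι S) ≡ S
  bits-ι          []      = refl
  bits-ι {suc n} (b ∷ S) = trans (bits-∷ n b (ι S)) (cong (b ∷_) (bits-ι S))

  ι-injective : ∀ {n} {A B : Subset n} → ι A ≡ ι B → A ≡ B
  ι-injective {n} {A} {B} ιA≡ιB = trans (sym (bits-ι A)) (trans (cong (bits n) ιA≡ιB) (bits-ι B))

  ι-bits : ∀ n t → t < 2 ^ n → ι (bits n t) ≡ t
  ι-bits zero    zero    _         = refl
  ι-bits zero    (suc t) (s≤s ())
  ι-bits (suc n) t       t<2^[1+n] = begin
    bit (t % 2 ≡ᵇ 1) + 2 * ι (bits n (t / 2))  ≡⟨ cong₂ (λ r q → r + 2 * q) (bit-parity (t % 2) (m%n<n t 2))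
                                                                         (ι-bits n (t / 2) t/2<2^n) ⟩
    t % 2 + 2 * (t / 2)                        ≡⟨ cong (t % 2 +_) (*-comm 2 (t / 2)) ⟩
    t % 2 + t / 2 * 2                          ≡⟨ sym (m≡m%n+[m/n]*n t 2) ⟩
    t                                          ∎
    where
      open ≡.≡-Reasoning
      bit-parity : ∀ r → r < 2 → bit (r ≡ᵇ 1) ≡ r
      bit-parity 0             _                = refl
      bit-parity 1             _                = refl
      bit-parity (suc (suc r)) (s≤s (s≤s ()))
      t/2<2^n : t / 2 < 2 ^ n
      t/2<2^n = m<n*o⇒m/o<n (subst (t <_) (*-comm 2 (2 ^ n)) t<2^[1+n])

  majority : Bool → Bool → Bool → Bool
  majority a b c = if a xor b then c else a

  full-adder : ∀ a b c → bit a + bit b + bit c ≡ bit (a xor b xor c) + 2 * bit (majority a b c)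
  full-adder false false false = refl
  full-adder false false true  = refl
  full-adder false true  false = refl
  full-adder false true  true  = refl
  full-adder true  false false = refl
  full-adder true  false true  = refl
  full-adder true  true  false = refl
  full-adder true  true  true  = refl

  addWithCarry : ∀ {n} → Bool → Subset n → Subset n → Subset n
  addWithCarry c []      []      = []
  addWithCarry c (a ∷ A) (b ∷ B) = (a xor b xor c) ∷ addWithCarry (majority a b c) A B

  carryOut : ∀ {n} → Bool → Subset n → Subset n → Bool
  carryOut c []      []      = c
  carryOut c (a ∷ A) (b ∷ B) = carryOut (majority a b c) A B

  ι-addWithCarry : ∀ {n} c (A B : Subset n) →
                   ι A + ι B + bit c ≡ ι (addWithCarry c A B) + 2 ^ n * bit (carryOut c A B)
  ι-addWithCarry         c []      []      = +-comm 0 (bit c)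
  ι-addWithCarry {suc n} c (a ∷ A) (b ∷ B) = begin
    bit a + 2 * ι A + (bit b + 2 * ι B) + bit c  ≡⟨ regroup (bit a) (bit b) (bit c) (ι A) (ι B) ⟩
    bit a + bit b + bit c + 2 * (ι A + ι B)      ≡⟨ cong (_+ 2 * (ι A + ι B)) (full-adder a b c) ⟩
    bit s + 2 * bit c′ + 2 * (ι A + ι B)         ≡⟨ carry-in (bit s) (bit c′) (ι A + ι B) ⟩
    bit s + 2 * (ι A + ι B + bit c′)             ≡⟨ cong (λ m → bit s + 2 * m) (ι-addWithCarry c′ A B) ⟩
    bit s + 2 * (ι R + 2 ^ n * bit c″)           ≡⟨ carry-out (bit s) (ι R) (2 ^ n) (bit c″) ⟩
    bit s + 2 * ι R + 2 * 2 ^ n * bit c″         ∎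
    where
      open ≡.≡-Reasoning
      s c′ c″ : Bool
      s  = a xor b xor c
      c′ = majority a b c
      c″ = carryOut c′ A B
      R : Subset n
      R  = addWithCarry c′ A B
      regroup : ∀ x y z u v → x + 2 * u + (y + 2 * v) + z ≡ x + y + z + 2 * (u + v)
      regroup = solve-∀
      carry-in : ∀ x y z → x + 2 * y + 2 * z ≡ x + 2 * (z + y)
      carry-in = solve-∀
      carry-out : ∀ x y z w → x + 2 * (y + z * w) ≡ x + 2 * y + 2 * z * w
      carry-out = solve-∀

  ∣addWithCarry∣≤ : ∀ {n} c (A B : Subset n) →
                    ∣ addWithCarry c A B ∣ + bit (carryOut c A B) ≤ ∣ A ∣ + ∣ B ∣ + bit c
  ∣addWithCarry∣≤         c []      []      = ≤-refl
  ∣addWithCarry∣≤ {suc n} c (a ∷ A) (b ∷ B) = begin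
    ∣ s ∷ R ∣ + bit c″                           ≡⟨ cong (_+ bit c″) (∣∷∣ s R) ⟩
    bit s + ∣ R ∣ + bit c″                       ≡⟨ +-assoc (bit s) ∣ R ∣ (bit c″) ⟩
    bit s + (∣ R ∣ + bit c″)                     ≤⟨ +-monoʳ-≤ (bit s) (∣addWithCarry∣≤ c′ A B) ⟩
    bit s + (∣ A ∣ + ∣ B ∣ + bit c′)             ≤⟨ +-monoʳ-≤ (bit s) (+-monoʳ-≤ (∣ A ∣ + ∣ B ∣) (m≤n+m (bit c′) (bit c′))) ⟩
    bit s + (∣ A ∣ + ∣ B ∣ + (bit c′ + bit c′))  ≡⟨ regroup (bit s) ∣ A ∣ ∣ B ∣ (bit c′) ⟩
    bit s + 2 * bit c′ + (∣ A ∣ + ∣ B ∣)         ≡⟨ cong (_+ (∣ A ∣ + ∣ B ∣)) (sym (full-adder a b c)) ⟩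
    bit a + bit b + bit c + (∣ A ∣ + ∣ B ∣)      ≡⟨ regroup′ (bit a) (bit b) (bit c) ∣ A ∣ ∣ B ∣ ⟩
    bit a + ∣ A ∣ + (bit b + ∣ B ∣) + bit c      ≡⟨ cong₂ (λ x y → x + y + bit c) (sym (∣∷∣ a A)) (sym (∣∷∣ b B)) ⟩
    ∣ a ∷ A ∣ + ∣ b ∷ B ∣ + bit c                ∎
    where
      open ≤-Reasoning
      s c′ c″ : Bool
      s  = a xor b xor c
      c′ = majority a b c
      c″ = carryOut c′ A B
      R : Subset n
      R  = addWithCarry c′ A B
      regroup : ∀ x y z w → x + (y + z + (w + w)) ≡ x + 2 * w + (y + z)
      regroup = solve-∀
      regroup′ : ∀ x y z u v → x + y + z + (u + v) ≡ x + u + (y + v) + z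
      regroup′ = solve-∀

  no-weight-loss⇒split : ∀ {n} (A B : Subset n) → ∣ A ∣ + ∣ B ∣ ≤ ∣ addWithCarry false A B ∣ →
                         B ≡ addWithCarry false A B ─ A × A ⊆ addWithCarry false A B
  no-weight-loss⇒split []          []          _ = refl , λ x∈[] → x∈[]
  no-weight-loss⇒split (false ∷ A) (false ∷ B) h with no-weight-loss⇒split A B h
  ... | B≡R─A , A⊆R = cong (false ∷_) B≡R─A , out⊆ A⊆R
  no-weight-loss⇒split (false ∷ A) (true ∷ B)  h
    with no-weight-loss⇒split A B (≤-pred (subst (_≤ suc ∣ addWithCarry false A B ∣) (+-suc ∣ A ∣ ∣ B ∣) h))
  ... | B≡R─A , A⊆R = cong (true ∷_) B≡R─A , out⊆ A⊆R
  no-weight-loss⇒split (true ∷ A)  (false ∷ B) h with no-weight-loss⇒split A B (≤-pred h)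
  ... | B≡R─A , A⊆R = cong (false ∷_) B≡R─A , in⊆in A⊆R
  -- two set bits produce a carry, so by ∣addWithCarry∣≤ the sum has strictly smaller weight
  no-weight-loss⇒split (true ∷ A)  (true ∷ B)  h =
    contradiction (subst (suc (∣ A ∣ + suc ∣ B ∣) ≤_) weight≡ overfull) 1+n≰n
    where
      overfull : suc (∣ A ∣ + suc ∣ B ∣) ≤ ∣ A ∣ + ∣ B ∣ + 1
      overfull = ≤-trans h (≤-trans (m≤m+n _ _) (∣addWithCarry∣≤ true A B))
      weight≡ : ∣ A ∣ + ∣ B ∣ + 1 ≡ ∣ A ∣ + suc ∣ B ∣
      weight≡ = trans (+-assoc ∣ A ∣ ∣ B ∣ 1) (cong (∣ A ∣ +_) (+-comm ∣ B ∣ 1))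

  addWithCarry-─ : ∀ {n} {A S : Subset n} → A ⊆ S → addWithCarry false A (S ─ A) ≡ S
  addWithCarry-─ {A = []}        {[]}        _   = refl
  addWithCarry-─ {A = false ∷ A} {false ∷ S} A⊆S = cong (false ∷_) (addWithCarry-─ (drop-∷-⊆ A⊆S))
  addWithCarry-─ {A = false ∷ A} {true ∷ S}  A⊆S = cong (true ∷_) (addWithCarry-─ (drop-∷-⊆ A⊆S))
  addWithCarry-─ {A = true ∷ A}  {false ∷ S} A⊆S = contradiction (A⊆S here) λ ()
  addWithCarry-─ {A = true ∷ A}  {true ∷ S}  A⊆S = cong (true ∷_) (addWithCarry-─ (drop-∷-⊆ A⊆S))

  ∣p∣+∣q─p∣≡∣q∣ : ∀ {n} {p q : Subset n} → p ⊆ q → ∣ p ∣ + ∣ q ─ p ∣ ≡ ∣ q ∣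
  ∣p∣+∣q─p∣≡∣q∣ {p = []}        {[]}        _   = refl
  ∣p∣+∣q─p∣≡∣q∣ {p = false ∷ p} {false ∷ q} p⊆q = ∣p∣+∣q─p∣≡∣q∣ (drop-∷-⊆ p⊆q)
  ∣p∣+∣q─p∣≡∣q∣ {p = false ∷ p} {true ∷ q}  p⊆q = trans (+-suc ∣ p ∣ _) (cong suc (∣p∣+∣q─p∣≡∣q∣ (drop-∷-⊆ p⊆q)))
  ∣p∣+∣q─p∣≡∣q∣ {p = true ∷ p}  {false ∷ q} p⊆q = contradiction (p⊆q here) λ ()
  ∣p∣+∣q─p∣≡∣q∣ {p = true ∷ p}  {true ∷ q}  p⊆q = cong suc (∣p∣+∣q─p∣≡∣q∣ (drop-∷-⊆ p⊆q))

  module _ {n : ℕ} where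
    private instance
      2^n≢0 : NonZero (2 ^ n)
      2^n≢0 = m^n≢0 2 n

    ι-+-mod : ∀ (A B : Subset n) → (ι A + ι B) % 2 ^ n ≡ ι (addWithCarry false A B)
    ι-+-mod A B = begin
      (ι A + ι B) % 2 ^ n              ≡⟨ cong (_% 2 ^ n) (trans (sym (+-identityʳ _)) (ι-addWithCarry false A B)) ⟩
      (ι R + 2 ^ n * bit c) % 2 ^ n    ≡⟨ cong (λ m → (ι R + m) % 2 ^ n) (*-comm (2 ^ n) (bit c)) ⟩
      (ι R + bit c * 2 ^ n) % 2 ^ n    ≡⟨ [m+kn]%n≡m%n (ι R) (bit c) (2 ^ n) ⟩
      ι R % 2 ^ n                      ≡⟨ m<n⇒m%n≡m (ι<N R) ⟩
      ι R                              ∎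
      where
        open ≡.≡-Reasoning
        R : Subset n
        R = addWithCarry false A B
        c : Bool
        c = carryOut false A B

    split⇔ι-+×size : ∀ (A B S : Subset n) →
                     ((ι A + ι B) % 2 ^ n ≡ ι S × ∣ A ∣ + ∣ B ∣ ≡ ∣ S ∣) ⇔ (B ≡ S ─ A × A ⊆ S)
    split⇔ι-+×size A B S = mk⇔ split complete
      where
        split : (ι A + ι B) % 2 ^ n ≡ ι S × ∣ A ∣ + ∣ B ∣ ≡ ∣ S ∣ → B ≡ S ─ A × A ⊆ S
        split (ι≡ , size≡) = subst (λ R → B ≡ R ─ A × A ⊆ R) A+B≡S (no-weight-loss⇒split A B (≤-reflexive weight≡))
          where
            A+B≡S : addWithCarry false A B ≡ S
            A+B≡S = ι-injective (trans (sym (ι-+-mod A B)) ι≡)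
            weight≡ : ∣ A ∣ + ∣ B ∣ ≡ ∣ addWithCarry false A B ∣
            weight≡ = trans size≡ (cong ∣_∣ (sym A+B≡S))
        complete : B ≡ S ─ A × A ⊆ S → (ι A + ι B) % 2 ^ n ≡ ι S × ∣ A ∣ + ∣ B ∣ ≡ ∣ S ∣
        complete (refl , A⊆S) = trans (ι-+-mod A (S ─ A)) (cong ι (addWithCarry-─ A⊆S)) , ∣p∣+∣q─p∣≡∣q∣ A⊆S

module Sums {c ℓ : Level} (R : CommutativeRing c ℓ) where

  open CommutativeRing R
  open SubsetConvolution R
  open import Algebra.Properties.Semiring.Sum semiring
  open import Algebra.Properties.CommutativeSemigroup +-commutativeSemigroup using (interchange)
  open import Data.Fin.Subset using (inside; outside)
  open import Relation.Binary.Reasoning.Setoid setoid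
  open Binary using (bits-∷)

  if-*ˡ : ∀ b x y → (if b then x else 0#) * y ≈ (if b then x * y else 0#)
  if-*ˡ true  x y = refl
  if-*ˡ false x y = zeroˡ y

  if-*ʳ : ∀ b x y → x * (if b then y else 0#) ≈ (if b then x * y else 0#)
  if-*ʳ true  x y = refl
  if-*ʳ false x y = zeroʳ x

  *-indicator : ∀ b x → x * (if b then 1# else 0#) ≈ (if b then x else 0#)
  *-indicator true  x = *-identityʳ x
  *-indicator false x = zeroʳ x

  if-cong : ∀ b {x y} → x ≈ y → (if b then x else 0#) ≈ (if b then y else 0#)
  if-cong true  x≈y = x≈y
  if-cong false _   = refl

  if-∧ : ∀ b b′ x → (if b then (if b′ then x else 0#) else 0#) ≡ (if b ∧ b′ then x else 0#)
  if-∧ true  b′ x = ≡.refl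
  if-∧ false b′ x = ≡.refl

  ∑-if : ∀ {m} b (x : Fin m → Carrier) → ∑[ i < m ] (if b then x i else 0#) ≈ (if b then sum x else 0#)
  ∑-if     true  x = refl
  ∑-if {m} false x = sum-replicate-zero m

  ∑-pick : ∀ m j (F : ℕ → Carrier) →
           ∑[ i < m ] (if j ℕ.≡ᵇ toℕ i then F (toℕ i) else 0#) ≈ (if does (j ℕ.<? m) then F j else 0#)
  ∑-pick ℕ.zero    j         F = refl
  ∑-pick (ℕ.suc m) ℕ.zero    F = trans (+-congˡ (sum-replicate-zero m)) (+-identityʳ (F 0))
  ∑-pick (ℕ.suc m) (ℕ.suc j) F = trans (+-identityˡ _) (∑-pick m j (λ k → F (ℕ.suc k)))

  sumSubsets-cong : ∀ {n} {F G : Subset n → Carrier} → (∀ S → F S ≈ G S) → sumSubsets F ≈ sumSubsets G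
  sumSubsets-cong {ℕ.zero}  F≈G = F≈G []
  sumSubsets-cong {ℕ.suc n} F≈G =
    +-cong (sumSubsets-cong (λ S → F≈G (outside ∷ S))) (sumSubsets-cong (λ S → F≈G (inside ∷ S)))

  sumSubsets-zero : ∀ {n} → sumSubsets {n} (λ _ → 0#) ≈ 0#
  sumSubsets-zero {ℕ.zero}  = refl
  sumSubsets-zero {ℕ.suc n} = trans (+-cong (sumSubsets-zero {n}) (sumSubsets-zero {n})) (+-identityˡ 0#)

  sumSubsets-∑ : ∀ {n k} (F : Fin k → Subset n → Carrier) →
                 sumSubsets (λ A → ∑[ i < k ] F i A) ≈ ∑[ i < k ] sumSubsets (F i)
  sumSubsets-∑ {ℕ.zero}      F = refl
  sumSubsets-∑ {ℕ.suc n} {k} F =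
    trans (+-cong (sumSubsets-∑ F₀) (sumSubsets-∑ F₁)) (sym (∑-distrib-+ (λ i → sumSubsets (F₀ i)) (λ i → sumSubsets (F₁ i))))
    where
      F₀ F₁ : Fin k → Subset n → Carrier
      F₀ i A = F i (outside ∷ A)
      F₁ i A = F i (inside ∷ A)

  sumSubsets-select : ∀ {n} (C : Subset n) (Ψ : Subset n → Carrier) →
                      sumSubsets (λ B → if does (≡-dec _≟ᵇ_ B C) then Ψ B else 0#) ≈ Ψ C
  sumSubsets-select          []          Ψ = refl
  sumSubsets-select {ℕ.suc n} (false ∷ C) Ψ =
    trans (+-congˡ (sumSubsets-zero {n})) (trans (+-identityʳ _) (sumSubsets-select C (λ B → Ψ (false ∷ B))))
  sumSubsets-select {ℕ.suc n} (true ∷ C)  Ψ =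
    trans (+-congʳ (sumSubsets-zero {n})) (trans (+-identityˡ _) (sumSubsets-select C (λ B → Ψ (true ∷ B))))

  ∑-parity-split : ∀ M (φ : ℕ → Carrier) →
                   ∑[ t < 2 ℕ.* M ] φ (toℕ t) ≈ ∑[ x < M ] φ (2 ℕ.* toℕ x) + ∑[ x < M ] φ (1 ℕ.+ 2 ℕ.* toℕ x)
  ∑-parity-split ℕ.zero    φ = sym (+-identityˡ 0#)
  ∑-parity-split (ℕ.suc M) φ = begin
    ∑[ t < 2 ℕ.* ℕ.suc M ] φ (toℕ t)                ≡⟨ ≡.cong (λ k → ∑[ t < k ] φ (toℕ t)) (ℕₚ.*-suc 2 M) ⟩
    φ 0 + (φ 1 + ∑[ t < 2 ℕ.* M ] φ (2 ℕ.+ toℕ t))  ≈⟨ +-congˡ (+-congˡ (∑-parity-split M (λ t → φ (2 ℕ.+ t)))) ⟩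
    φ 0 + (φ 1 + (evens + odds))                    ≈⟨ sym (+-assoc (φ 0) (φ 1) (evens + odds)) ⟩
    φ 0 + φ 1 + (evens + odds)                      ≈⟨ interchange (φ 0) (φ 1) evens odds ⟩
    (φ 0 + evens) + (φ 1 + odds)                    ≡⟨ ≡.sym (≡.cong₂ (λ e o → φ 0 + e + (φ 1 + o))
                                                          (sum-cong-≗ {M} λ x → ≡.cong φ (ℕₚ.*-suc 2 (toℕ x)))
                                                          (sum-cong-≗ {M} λ x → ≡.cong (λ y → φ (ℕ.suc y)) (ℕₚ.*-suc 2 (toℕ x)))) ⟩
    ∑[ x < ℕ.suc M ] φ (2 ℕ.* toℕ x) + ∑[ x < ℕ.suc M ] φ (1 ℕ.+ 2 ℕ.* toℕ x) ∎
    where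
      evens odds : Carrier
      evens = ∑[ x < M ] φ (2 ℕ.+ 2 ℕ.* toℕ x)
      odds  = ∑[ x < M ] φ (3 ℕ.+ 2 ℕ.* toℕ x)

  ∑-bits : ∀ n (H : Subset n → Carrier) → ∑[ t < 2 ℕ.^ n ] H (bits n (toℕ t)) ≈ sumSubsets H
  ∑-bits ℕ.zero    H = +-identityʳ (H [])
  ∑-bits (ℕ.suc n) H = begin
    ∑[ t < 2 ℕ.^ ℕ.suc n ] H (bits (ℕ.suc n) (toℕ t))
      ≈⟨ ∑-parity-split (2 ℕ.^ n) (λ t → H (bits (ℕ.suc n) t)) ⟩
    ∑[ x < 2 ℕ.^ n ] H (bits (ℕ.suc n) (2 ℕ.* toℕ x)) + ∑[ x < 2 ℕ.^ n ] H (bits (ℕ.suc n) (1 ℕ.+ 2 ℕ.* toℕ x))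
      ≡⟨ ≡.cong₂ _+_ (sum-cong-≗ {2 ℕ.^ n} λ x → ≡.cong H (bits-∷ n false (toℕ x)))
                     (sum-cong-≗ {2 ℕ.^ n} λ x → ≡.cong H (bits-∷ n true (toℕ x))) ⟩
    ∑[ x < 2 ℕ.^ n ] H (outside ∷ bits n (toℕ x)) + ∑[ x < 2 ℕ.^ n ] H (inside ∷ bits n (toℕ x))
      ≈⟨ +-cong (∑-bits n (λ A → H (outside ∷ A))) (∑-bits n (λ A → H (inside ∷ A))) ⟩
    sumSubsets H ∎

module Fourier {c ℓ : Level} (R : CommutativeRing c ℓ) where

  open CommutativeRing R
  open SubsetConvolution R using (Vector; DFT; IDFT; pow; natCast)
  open import Algebra.Properties.Semiring.Sum semiring
  open import Algebra.Properties.Semiring.Exp semiring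
  open import Algebra.Properties.CommutativeSemiring.Exp commutativeSemiring using (^-distrib-*)
  open import Algebra.Properties.CommutativeSemigroup *-commutativeSemigroup using (interchange)
  open import Data.Maybe using (nothing)
  open import Data.Nat.DivMod using (_%_)
  open import Relation.Binary.Reasoning.Setoid setoid
  open import Tactic.RingSolver.Core.AlmostCommutativeRing using (AlmostCommutativeRing; fromCommutativeRing)

  private
    almostCommutativeRing : AlmostCommutativeRing c ℓ
    almostCommutativeRing = fromCommutativeRing R (λ _ → nothing)

  open import Tactic.RingSolver.NonReflective almostCommutativeRing using (solve; _⊜_; _⊕_; _⊗_; Κ)

  cyclicConv : ∀ {N} .{{_ : ℕ.NonZero N}} → Vector N → Vector N → Vector N
  cyclicConv {N} u v t = ∑[ a < N ] ∑[ b < N ] (if does ((toℕ a ℕ.+ toℕ b) % N ℕ.≟ toℕ t) then u a * v b else 0#)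

  ∑-*-∑ : ∀ {m n} (x : Fin m → Carrier) (y : Fin n → Carrier) → sum x * sum y ≈ ∑[ a < m ] ∑[ b < n ] (x a * y b)
  ∑-*-∑ {m} x y = trans (*-distribʳ-sum (sum y) x) (sum-cong-≋ {m} λ a → *-distribˡ-sum (x a) y)

  IDFT-∑ : ∀ {N k} (ω Ninv : Carrier) (x : Fin k → Vector N) (t : Fin N) →
           IDFT ω Ninv (λ m → ∑[ i < k ] x i m) t ≈ ∑[ i < k ] IDFT ω Ninv (x i) t
  IDFT-∑ {N} {k} ω Ninv x t = begin
    Ninv * ∑[ m < N ] (∑[ i < k ] x i m * w m)    ≈⟨ *-congˡ (sum-cong-≋ {N} λ m → *-distribʳ-sum (w m) (λ i → x i m)) ⟩
    Ninv * ∑[ m < N ] ∑[ i < k ] (x i m * w m)    ≈⟨ *-congˡ (∑-comm (λ m i → x i m * w m)) ⟩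
    Ninv * ∑[ i < k ] ∑[ m < N ] (x i m * w m)    ≈⟨ *-distribˡ-sum Ninv (λ i → ∑[ m < N ] (x i m * w m)) ⟩
    ∑[ i < k ] IDFT ω Ninv (x i) t                ∎
    where
      w : Fin N → Carrier
      w m = ω ^ (toℕ m ℕ.* toℕ t)

  x^[m*e]≈[x^e]^m : ∀ x e m → x ^ (m ℕ.* e) ≈ (x ^ e) ^ m
  x^[m*e]≈[x^e]^m x e m = trans (^-congʳ x (ℕₚ.*-comm m e)) (sym (^-assocʳ x e m))

  DFT*DFT : ∀ {N} (ω ω̄ : Carrier) (u v : Vector N) (m t : Fin N) →
            DFT ω̄ u m * DFT ω̄ v m * ω ^ (toℕ m ℕ.* toℕ t)
              ≈ ∑[ a < N ] ∑[ b < N ] ((u a * v b) * (ω̄ ^ (toℕ a ℕ.+ toℕ b) * ω ^ toℕ t) ^ toℕ m)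
  DFT*DFT {N} ω ω̄ u v m t = begin
    DFT ω̄ u m * DFT ω̄ v m * r
      ≈⟨ *-congʳ (∑-*-∑ (λ a → u a * p a) (λ b → v b * p b)) ⟩
    (∑[ a < N ] ∑[ b < N ] ((u a * p a) * (v b * p b))) * r
      ≈⟨ *-distribʳ-sum r (λ a → ∑[ b < N ] ((u a * p a) * (v b * p b))) ⟩
    ∑[ a < N ] (∑[ b < N ] ((u a * p a) * (v b * p b)) * r)
      ≈⟨ sum-cong-≋ {N} (λ a → trans (*-distribʳ-sum r (λ b → (u a * p a) * (v b * p b))) (sum-cong-≋ {N} (term a))) ⟩
    ∑[ a < N ] ∑[ b < N ] ((u a * v b) * (ω̄ ^ (toℕ a ℕ.+ toℕ b) * ω ^ toℕ t) ^ toℕ m) ∎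
    where
      p : Fin N → Carrier
      p a = ω̄ ^ (toℕ m ℕ.* toℕ a)
      r : Carrier
      r = ω ^ (toℕ m ℕ.* toℕ t)
      term : ∀ a b → (u a * p a) * (v b * p b) * r ≈ (u a * v b) * (ω̄ ^ (toℕ a ℕ.+ toℕ b) * ω ^ toℕ t) ^ toℕ m
      term a b = begin
        (u a * p a) * (v b * p b) * r
          ≈⟨ trans (*-congʳ (interchange (u a) (p a) (v b) (p b))) (*-assoc (u a * v b) (p a * p b) r) ⟩
        (u a * v b) * (p a * p b * r)
          ≈⟨ *-congˡ (*-congʳ (sym (^-homo-* ω̄ (toℕ m ℕ.* toℕ a) (toℕ m ℕ.* toℕ b)))) ⟩
        (u a * v b) * (ω̄ ^ (toℕ m ℕ.* toℕ a ℕ.+ toℕ m ℕ.* toℕ b) * r)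
          ≈⟨ *-congˡ (*-congʳ (^-congʳ ω̄ (≡.sym (ℕₚ.*-distribˡ-+ (toℕ m) (toℕ a) (toℕ b))))) ⟩
        (u a * v b) * (ω̄ ^ (toℕ m ℕ.* (toℕ a ℕ.+ toℕ b)) * r)
          ≈⟨ *-congˡ (*-cong (x^[m*e]≈[x^e]^m ω̄ (toℕ a ℕ.+ toℕ b) (toℕ m)) (x^[m*e]≈[x^e]^m ω (toℕ t) (toℕ m))) ⟩
        (u a * v b) * ((ω̄ ^ (toℕ a ℕ.+ toℕ b)) ^ toℕ m * (ω ^ toℕ t) ^ toℕ m)
          ≈⟨ *-congˡ (sym (^-distrib-* (ω̄ ^ (toℕ a ℕ.+ toℕ b)) (ω ^ toℕ t) (toℕ m))) ⟩
        (u a * v b) * (ω̄ ^ (toℕ a ℕ.+ toℕ b) * ω ^ toℕ t) ^ toℕ m ∎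

  1^k≈1 : ∀ k → 1# ^ k ≈ 1#
  1^k≈1 ℕ.zero    = refl
  1^k≈1 (ℕ.suc k) = trans (*-identityˡ _) (1^k≈1 k)

  powerSum : ℕ → Carrier → Carrier
  powerSum K z = ∑[ m < K ] (z ^ toℕ m)

  geometric-sum : ∀ K z → z * powerSum K z + 1# ≈ powerSum K z + z ^ K
  geometric-sum ℕ.zero    z = +-congʳ (zeroʳ z)
  geometric-sum (ℕ.suc K) z = begin
    z * (1# + ∑[ m < K ] (z * z ^ toℕ m)) + 1#  ≈⟨ +-congʳ (*-congˡ (+-congˡ (sym (*-distribˡ-sum {K} z (λ m → z ^ toℕ m))))) ⟩
    z * (1# + z * G) + 1#                       ≈⟨ shift z G ⟩
    1# + z * (z * G + 1#)                       ≈⟨ +-congˡ (*-congˡ (geometric-sum K z)) ⟩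
    1# + z * (G + z ^ K)                        ≈⟨ +-congˡ (distribˡ z G (z ^ K)) ⟩
    1# + (z * G + z * z ^ K)                    ≈⟨ sym (+-assoc 1# (z * G) (z * z ^ K)) ⟩
    1# + z * G + z * z ^ K                      ≈⟨ +-congʳ (+-congˡ (*-distribˡ-sum {K} z (λ m → z ^ toℕ m))) ⟩
    1# + ∑[ m < K ] (z * z ^ toℕ m) + z ^ ℕ.suc K ∎
    where
      G : Carrier
      G = powerSum K z
      shift : ∀ z G → z * (1# + z * G) + 1# ≈ 1# + z * (z * G + 1#)
      shift = solve 2 (λ z G → (z ⊗ (Κ 1# ⊕ z ⊗ G) ⊕ Κ 1#) ⊜ (Κ 1# ⊕ z ⊗ (z ⊗ G ⊕ Κ 1#))) refl

  module PrimitiveRoot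
    (noZeroDivisors : ∀ x y → x * y ≈ 0# → x ≈ 0# ⊎ y ≈ 0#)
    (N : ℕ) {{_ : ℕ.NonZero N}} (ω ω̄ Ninv : Carrier)
    (ω*ω̄≈1 : ω * ω̄ ≈ 1#) (ω^N≈1 : pow ω N ≈ 1#) (ω-primitive : ∀ t → 0 < t → t < N → ¬ pow ω t ≈ 1#)
    (N*Ninv≈1 : natCast N * Ninv ≈ 1#)
    where

    open import Algebra.Properties.CommutativeSemigroup *-commutativeSemigroup using (x∙yz≈y∙xz)
    open import Algebra.Properties.Ring ring using ([y-z]x≈yx-zx)
    open import Algebra.Properties.Group +-group using (x∙y⁻¹≈ε⇒x≈y; ∙-cancelʳ)
    open import Data.Fin.Properties using (toℕ<n)
    open import Data.Nat.DivMod using (_/_; m≡m%n+[m/n]*n; m%n<n)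
    open import Data.Sum using (inj₁; inj₂)
    open import Relation.Binary.Definitions using (tri<; tri≈; tri>)
    open Sums R using (*-indicator)

    ω̄^k*ω^k≈1 : ∀ k → ω̄ ^ k * ω ^ k ≈ 1#
    ω̄^k*ω^k≈1 k = trans (sym (^-distrib-* ω̄ ω k)) (trans (^-congˡ k (trans (*-comm ω̄ ω) ω*ω̄≈1)) (1^k≈1 k))

    ω̄^N≈1 : ω̄ ^ N ≈ 1#
    ω̄^N≈1 = trans (sym (*-identityʳ _)) (trans (*-congˡ (sym ω^N≈1)) (ω̄^k*ω^k≈1 N))

    [x^a]^N≈1 : ∀ {x} → x ^ N ≈ 1# → ∀ a → (x ^ a) ^ N ≈ 1#
    [x^a]^N≈1 {x} x^N≈1 a = begin
      (x ^ a) ^ N    ≈⟨ ^-assocʳ x a N ⟩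
      x ^ (a ℕ.* N)  ≈⟨ ^-congʳ x (ℕₚ.*-comm a N) ⟩
      x ^ (N ℕ.* a)  ≈⟨ sym (^-assocʳ x N a) ⟩
      (x ^ N) ^ a    ≈⟨ ^-congˡ a x^N≈1 ⟩
      1# ^ a         ≈⟨ 1^k≈1 a ⟩
      1#             ∎

    ω^s≈ω^[s%N] : ∀ s → ω ^ s ≈ ω ^ (s % N)
    ω^s≈ω^[s%N] s = begin
      ω ^ s                              ≈⟨ ^-congʳ ω (≡.trans (m≡m%n+[m/n]*n s N) (≡.cong (s % N ℕ.+_) (ℕₚ.*-comm (s / N) N))) ⟩
      ω ^ (s % N ℕ.+ N ℕ.* (s / N))      ≈⟨ ^-homo-* ω (s % N) (N ℕ.* (s / N)) ⟩
      ω ^ (s % N) * ω ^ (N ℕ.* (s / N))  ≈⟨ *-congˡ (trans (sym (^-assocʳ ω N (s / N))) (trans (^-congˡ (s / N) ω^N≈1) (1^k≈1 (s / N)))) ⟩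
      ω ^ (s % N) * 1#                   ≈⟨ *-identityʳ _ ⟩
      ω ^ (s % N)                        ∎

    ω^-distinct : ∀ {x y} → x < y → y < N → ¬ ω ^ x ≈ ω ^ y
    ω^-distinct {x} {y} x<y y<N ω^x≈ω^y =
      ω-primitive (y ℕ.∸ x) (ℕₚ.m<n⇒0<n∸m x<y) (ℕₚ.≤-<-trans (ℕₚ.m∸n≤m y x) y<N) ω^[y∸x]≈1
      where
        ω^[y∸x]≈1 : ω ^ (y ℕ.∸ x) ≈ 1#
        ω^[y∸x]≈1 = begin
          ω ^ (y ℕ.∸ x)                     ≈⟨ sym (*-identityˡ _) ⟩
          1# * ω ^ (y ℕ.∸ x)                ≈⟨ *-congʳ (sym (ω̄^k*ω^k≈1 x)) ⟩
          ω̄ ^ x * ω ^ x * ω ^ (y ℕ.∸ x)    ≈⟨ *-assoc _ _ _ ⟩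
          ω̄ ^ x * (ω ^ x * ω ^ (y ℕ.∸ x))  ≈⟨ *-congˡ (sym (^-homo-* ω x (y ℕ.∸ x))) ⟩
          ω̄ ^ x * ω ^ (x ℕ.+ (y ℕ.∸ x))    ≈⟨ *-congˡ (^-congʳ ω (ℕₚ.m+[n∸m]≡n (ℕₚ.<⇒≤ x<y))) ⟩
          ω̄ ^ x * ω ^ y                    ≈⟨ *-congˡ (sym ω^x≈ω^y) ⟩
          ω̄ ^ x * ω ^ x                    ≈⟨ ω̄^k*ω^k≈1 x ⟩
          1#                                ∎

    ω^-injective : ∀ {x y} → x < N → y < N → ω ^ x ≈ ω ^ y → x ≡ y
    ω^-injective {x} {y} x<N y<N ω^x≈ω^y with ℕₚ.<-cmp x y
    ... | tri< x<y _ _ = contradiction ω^x≈ω^y (ω^-distinct x<y y<N)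
    ... | tri≈ _ x≡y _ = x≡y
    ... | tri> _ _ y<x = contradiction (sym ω^x≈ω^y) (ω^-distinct y<x x<N)

    powerSum-one : ∀ {K z} → z ≈ 1# → powerSum K z ≈ natCast K
    powerSum-one {K} z≈1 = trans (sum-cong-≋ {K} λ m → trans (^-congˡ (toℕ m) z≈1) (1^k≈1 (toℕ m))) (sum-replicate K)

    powerSum-vanishes : ∀ {z} → z ^ N ≈ 1# → ¬ z ≈ 1# → powerSum N z ≈ 0#
    powerSum-vanishes {z} z^N≈1 z≉1 with noZeroDivisors (z - 1#) G [z-1]G≈0
      where
        G : Carrier
        G = powerSum N z
        zG≈G : z * G ≈ G
        zG≈G = ∙-cancelʳ 1# (z * G) G (trans (geometric-sum N z) (+-congˡ z^N≈1))
        [z-1]G≈0 : (z - 1#) * G ≈ 0#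
        [z-1]G≈0 = begin
          (z - 1#) * G    ≈⟨ [y-z]x≈yx-zx G z 1# ⟩
          z * G - 1# * G  ≈⟨ +-cong zG≈G (-‿cong (*-identityˡ G)) ⟩
          G - G           ≈⟨ -‿inverseʳ G ⟩
          0#              ∎
    ... | inj₁ z-1≈0 = contradiction (x∙y⁻¹≈ε⇒x≈y z 1# z-1≈0) z≉1
    ... | inj₂ G≈0   = G≈0

    orthogonality : ∀ s {t} → t < N → Ninv * powerSum N (ω̄ ^ s * ω ^ t) ≈ (if does (s % N ℕ.≟ t) then 1# else 0#)
    orthogonality s {t} t<N = by-cases (s % N ℕ.≟ t)
      where
        z : Carrier
        z = ω̄ ^ s * ω ^ t
        z^N≈1 : z ^ N ≈ 1#
        z^N≈1 = trans (^-distrib-* (ω̄ ^ s) (ω ^ t) N) (trans (*-cong ([x^a]^N≈1 ω̄^N≈1 s) ([x^a]^N≈1 ω^N≈1 t)) (*-identityʳ 1#))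
        z≈1⇒ω^s≈ω^t : z ≈ 1# → ω ^ s ≈ ω ^ t
        z≈1⇒ω^s≈ω^t z≈1 = begin
          ω ^ s                    ≈⟨ sym (*-identityʳ _) ⟩
          ω ^ s * 1#               ≈⟨ *-congˡ (sym z≈1) ⟩
          ω ^ s * (ω̄ ^ s * ω ^ t)  ≈⟨ sym (*-assoc _ _ _) ⟩
          ω ^ s * ω̄ ^ s * ω ^ t    ≈⟨ *-congʳ (trans (*-comm _ _) (ω̄^k*ω^k≈1 s)) ⟩
          1# * ω ^ t               ≈⟨ *-identityˡ _ ⟩
          ω ^ t                    ∎
        by-cases : (d : Dec (s % N ≡ t)) → Ninv * powerSum N z ≈ (if does d then 1# else 0#)
        by-cases (yes s%N≡t) = begin
          Ninv * powerSum N z  ≈⟨ *-congˡ (powerSum-one {N} z≈1) ⟩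
          Ninv * natCast N     ≈⟨ *-comm Ninv (natCast N) ⟩
          natCast N * Ninv     ≈⟨ N*Ninv≈1 ⟩
          1#                   ∎
          where
            z≈1 : z ≈ 1#
            z≈1 = trans (*-congˡ (trans (^-congʳ ω (≡.sym s%N≡t)) (sym (ω^s≈ω^[s%N] s)))) (ω̄^k*ω^k≈1 s)
        by-cases (no s%N≢t) = trans (*-congˡ (powerSum-vanishes z^N≈1 z≉1)) (zeroʳ Ninv)
          where
            z≉1 : ¬ z ≈ 1#
            z≉1 z≈1 = s%N≢t (ω^-injective (m%n<n s N) t<N (trans (sym (ω^s≈ω^[s%N] s)) (z≈1⇒ω^s≈ω^t z≈1)))

    convolution-theorem : ∀ (u v : Vector N) (t : Fin N) →
                          IDFT ω Ninv (λ m → DFT ω̄ u m * DFT ω̄ v m) t ≈ cyclicConv u v t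
    convolution-theorem u v t = begin
      Ninv * ∑[ m < N ] (DFT ω̄ u m * DFT ω̄ v m * ω ^ (toℕ m ℕ.* toℕ t))
        ≈⟨ *-congˡ (sum-cong-≋ {N} λ m → DFT*DFT ω ω̄ u v m t) ⟩
      Ninv * ∑[ m < N ] ∑[ a < N ] ∑[ b < N ] (uv a b * z a b ^ toℕ m)
        ≈⟨ *-congˡ (trans (∑-comm {N} {N} _) (sum-cong-≋ {N} λ a → ∑-comm {N} {N} _)) ⟩
      Ninv * ∑[ a < N ] ∑[ b < N ] ∑[ m < N ] (uv a b * z a b ^ toℕ m)
        ≈⟨ trans (*-distribˡ-sum {N} Ninv _) (sum-cong-≋ {N} λ a → trans (*-distribˡ-sum {N} Ninv _) (sum-cong-≋ {N} (pull a))) ⟩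
      ∑[ a < N ] ∑[ b < N ] (uv a b * (Ninv * powerSum N (z a b)))
        ≈⟨ sum-cong-≋ {N} (λ a → sum-cong-≋ {N} λ b →
             trans (*-congˡ (orthogonality (toℕ a ℕ.+ toℕ b) (toℕ<n t))) (*-indicator _ (uv a b))) ⟩
      cyclicConv u v t ∎
      where
        uv : Fin N → Fin N → Carrier
        uv a b = u a * v b
        z : Fin N → Fin N → Carrier
        z a b = ω̄ ^ (toℕ a ℕ.+ toℕ b) * ω ^ toℕ t
        pull : ∀ a b → Ninv * ∑[ m < N ] (uv a b * z a b ^ toℕ m) ≈ uv a b * (Ninv * powerSum N (z a b))
        pull a b = trans (*-congˡ (sym (*-distribˡ-sum {N} (uv a b) _))) (x∙yz≈y∙xz Ninv (uv a b) _)

module Layers {c ℓ : Level} (R : CommutativeRing c ℓ) where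

  open CommutativeRing R
  open SubsetConvolution R
  open import Algebra.Properties.Semiring.Sum semiring
  open import Data.Fin.Properties using (toℕ<n; toℕ-fromℕ<)
  open import Data.Fin.Subset using (∣_∣; _─_)
  open import Data.Fin.Subset.Properties using (∣p∣≤n; _⊆?_)
  open import Data.Nat.DivMod using (_%_)
  open import Relation.Binary.Reasoning.Setoid setoid
  open Binary using (ι-bits; split⇔ι-+×size)
  open Sums R
  open Fourier R using (cyclicConv)

  layer : ∀ {n} (ω ω̄ Ninv : Carrier) (f g : SetFun n) → ℕ → SetFun n
  layer ω ω̄ Ninv f g k =
    fromVec (IDFT ω Ninv (λ m → ∑[ i < ℕ.suc k ] (DFT ω̄ (toVec (chop (toℕ i) f)) m * DFT ω̄ (toVec (chop (k ℕ.∸ toℕ i) g)) m)))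

  algorithm≈layer : ∀ {n} (ω ω̄ Ninv : Carrier) (f g : SetFun n) (S : Subset n) →
                    algorithm ω ω̄ Ninv f g S ≈ layer ω ω̄ Ninv f g ∣ S ∣ S
  algorithm≈layer {n} ω ω̄ Ninv f g S = begin
    algorithm ω ω̄ Ninv f g S
      ≈⟨ ∑-pick (ℕ.suc n) ∣ S ∣ (λ k → layer ω ω̄ Ninv f g k S) ⟩
    (if does (∣ S ∣ ℕ.<? ℕ.suc n) then layer ω ω̄ Ninv f g ∣ S ∣ S else 0#)
      ≡⟨ ≡.cong (λ b → if b then layer ω ω̄ Ninv f g ∣ S ∣ S else 0#) (dec-true (∣ S ∣ ℕ.<? ℕ.suc n) (ℕ.s≤s (∣p∣≤n S))) ⟩
    layer ω ω̄ Ninv f g ∣ S ∣ S ∎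

  ∑-chop-product : ∀ {n} (f g : SetFun n) K (A B : Subset n) →
                   ∑[ i < ℕ.suc K ] (chop (toℕ i) f A * chop (K ℕ.∸ toℕ i) g B)
                     ≈ (if does (∣ A ∣ ℕ.+ ∣ B ∣ ℕ.≟ K) then f A * g B else 0#)
  ∑-chop-product f g K A B = begin
    ∑[ i < ℕ.suc K ] (chop (toℕ i) f A * chop (K ℕ.∸ toℕ i) g B)
      ≈⟨ sum-cong-≋ {ℕ.suc K} (λ i → if-*ˡ (∣ A ∣ ℕ.≡ᵇ toℕ i) (f A) (chop (K ℕ.∸ toℕ i) g B)) ⟩
    ∑[ i < ℕ.suc K ] (if ∣ A ∣ ℕ.≡ᵇ toℕ i then f A * chop (K ℕ.∸ toℕ i) g B else 0#)
      ≈⟨ ∑-pick (ℕ.suc K) ∣ A ∣ (λ j → f A * chop (K ℕ.∸ j) g B) ⟩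
    (if does (∣ A ∣ ℕ.<? ℕ.suc K) then f A * chop (K ℕ.∸ ∣ A ∣) g B else 0#)
      ≈⟨ by-cases (∣ A ∣ ℕ.<? ℕ.suc K) ⟩
    (if does (∣ A ∣ ℕ.+ ∣ B ∣ ℕ.≟ K) then f A * g B else 0#) ∎
    where
      by-cases : (d : Dec (∣ A ∣ < ℕ.suc K)) →
                 (if does d then f A * chop (K ℕ.∸ ∣ A ∣) g B else 0#) ≈ (if does (∣ A ∣ ℕ.+ ∣ B ∣ ℕ.≟ K) then f A * g B else 0#)
      by-cases (yes (ℕ.s≤s ∣A∣≤K)) =
        trans (if-*ʳ (∣ B ∣ ℕ.≡ᵇ K ℕ.∸ ∣ A ∣) (f A) (g B))
              (reflexive (≡.cong (λ b → if b then f A * g B else 0#)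
                                 (does-⇔ complement (∣ B ∣ ℕ.≟ K ℕ.∸ ∣ A ∣) (∣ A ∣ ℕ.+ ∣ B ∣ ℕ.≟ K))))
        where
          complement : (∣ B ∣ ≡ K ℕ.∸ ∣ A ∣) ⇔ (∣ A ∣ ℕ.+ ∣ B ∣ ≡ K)
          complement = mk⇔ (λ B≡K∸A → ≡.trans (≡.cong (∣ A ∣ ℕ.+_) B≡K∸A) (ℕₚ.m+[n∸m]≡n ∣A∣≤K))
                           (λ A+B≡K → ≡.trans (≡.sym (ℕₚ.m+n∸m≡n ∣ A ∣ ∣ B ∣)) (≡.cong (ℕ._∸ ∣ A ∣) A+B≡K))
      by-cases (no ∣A∣≰K) =
        reflexive (≡.cong (λ b → if b then f A * g B else 0#) (≡.sym (dec-false (∣ A ∣ ℕ.+ ∣ B ∣ ℕ.≟ K) A+B≢K)))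
        where
          A+B≢K : ¬ ∣ A ∣ ℕ.+ ∣ B ∣ ≡ K
          A+B≢K A+B≡K = ∣A∣≰K (ℕ.s≤s (≡.subst (∣ A ∣ ≤_) A+B≡K (ℕₚ.m≤m+n ∣ A ∣ ∣ B ∣)))

  ∑-chop-indicator : ∀ {n} (f g : SetFun n) K c (A B : Subset n) →
                     ∑[ i < ℕ.suc K ] (if c then chop (toℕ i) f A * chop (K ℕ.∸ toℕ i) g B else 0#)
                       ≈ (if c ∧ does (∣ A ∣ ℕ.+ ∣ B ∣ ℕ.≟ K) then f A * g B else 0#)
  ∑-chop-indicator f g K c A B = begin
    ∑[ i < ℕ.suc K ] (if c then chop (toℕ i) f A * chop (K ℕ.∸ toℕ i) g B else 0#)
      ≈⟨ ∑-if {ℕ.suc K} c (λ i → chop (toℕ i) f A * chop (K ℕ.∸ toℕ i) g B) ⟩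
    (if c then ∑[ i < ℕ.suc K ] (chop (toℕ i) f A * chop (K ℕ.∸ toℕ i) g B) else 0#)
      ≈⟨ if-cong c (∑-chop-product f g K A B) ⟩
    (if c then (if does (∣ A ∣ ℕ.+ ∣ B ∣ ℕ.≟ K) then f A * g B else 0#) else 0#)
      ≡⟨ if-∧ c _ (f A * g B) ⟩
    (if c ∧ does (∣ A ∣ ℕ.+ ∣ B ∣ ℕ.≟ K) then f A * g B else 0#) ∎

  module _ {n : ℕ} where
    private instance
      2^n≢0 : ℕ.NonZero (2 ℕ.^ n)
      2^n≢0 = ℕₚ.m^n≢0 2 n

    cyclicConv-toVec : ∀ (u v : SetFun n) (S : Subset n) →
                       cyclicConv (toVec u) (toVec v) (ιF S)
                         ≈ sumSubsets (λ A → sumSubsets (λ B → if does ((ι A ℕ.+ ι B) % 2 ℕ.^ n ℕ.≟ ι S) then u A * v B else 0#))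
    cyclicConv-toVec u v S = begin
      cyclicConv (toVec u) (toVec v) (ιF S)
        ≡⟨ sum-cong-≗ {N} (λ a → sum-cong-≗ {N} λ b → ≡.cong (λ c → if c then toVec u a * toVec v b else 0#) (reindex a b)) ⟩
      ∑[ a < N ] ∑[ b < N ] Y (bits n (toℕ a)) (bits n (toℕ b))
        ≈⟨ trans (sum-cong-≋ {N} λ a → ∑-bits n (Y (bits n (toℕ a)))) (∑-bits n (λ A → sumSubsets (Y A))) ⟩
      sumSubsets (λ A → sumSubsets (λ B → Y A B)) ∎
      where
        N : ℕ
        N = 2 ℕ.^ n
        Y : Subset n → Subset n → Carrier
        Y A B = if does ((ι A ℕ.+ ι B) % N ℕ.≟ ι S) then u A * v B else 0#
        reindex : ∀ a b → ((toℕ a ℕ.+ toℕ b) % N ℕ.≡ᵇ toℕ (ιF S))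
                            ≡ ((ι (bits n (toℕ a)) ℕ.+ ι (bits n (toℕ b))) % N ℕ.≡ᵇ ι S)
        reindex a b = ≡.cong₂ (λ s t → s % N ℕ.≡ᵇ t)
                              (≡.cong₂ ℕ._+_ (≡.sym (ι-bits n (toℕ a) (toℕ<n a))) (≡.sym (ι-bits n (toℕ b) (toℕ<n b))))
                              (toℕ-fromℕ< (ι<N S))

    ∑-cyclicConv≈conv : ∀ (f g : SetFun n) (S : Subset n) →
                        ∑[ i < ℕ.suc ∣ S ∣ ] cyclicConv (toVec (chop (toℕ i) f)) (toVec (chop (∣ S ∣ ℕ.∸ toℕ i) g)) (ιF S)
                          ≈ conv f g S
    ∑-cyclicConv≈conv f g S = begin
      ∑[ i < ℕ.suc K ] cyclicConv (toVec (chop (toℕ i) f)) (toVec (chop (K ℕ.∸ toℕ i) g)) (ιF S)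
        ≈⟨ sum-cong-≋ {ℕ.suc K} (λ i → cyclicConv-toVec (chop (toℕ i) f) (chop (K ℕ.∸ toℕ i) g) S) ⟩
      ∑[ i < ℕ.suc K ] sumSubsets (λ A → sumSubsets (λ B → X (toℕ i) A B))
        ≈⟨ sym (sumSubsets-∑ {k = ℕ.suc K} (λ i A → sumSubsets (X (toℕ i) A))) ⟩
      sumSubsets (λ A → ∑[ i < ℕ.suc K ] sumSubsets (X (toℕ i) A))
        ≈⟨ sumSubsets-cong (λ A → sym (sumSubsets-∑ {k = ℕ.suc K} (λ i → X (toℕ i) A))) ⟩
      sumSubsets (λ A → sumSubsets (λ B → ∑[ i < ℕ.suc K ] X (toℕ i) A B))
        ≈⟨ sumSubsets-cong (λ A → sumSubsets-cong λ B → ∑-chop-indicator f g K (does (ι-sum? A B)) A B) ⟩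
      sumSubsets (λ A → sumSubsets (λ B → if does (ι-sum? A B ×-dec size? A B) then f A * g B else 0#))
        ≈⟨ sumSubsets-cong (λ A → sumSubsets-cong λ B → reflexive (split-indicator A B)) ⟩
      sumSubsets (λ A → sumSubsets (λ B → if does (≡-dec _≟ᵇ_ B (S ─ A)) then (if does (A ⊆? S) then f A * g B else 0#) else 0#))
        ≈⟨ sumSubsets-cong (λ A → sumSubsets-select (S ─ A) (λ B → if does (A ⊆? S) then f A * g B else 0#)) ⟩
      conv f g S ∎
      where
        K : ℕ
        K = ∣ S ∣
        ι-sum? : ∀ A B → Dec ((ι A ℕ.+ ι B) % 2 ℕ.^ n ≡ ι S)
        ι-sum? A B = (ι A ℕ.+ ι B) % 2 ℕ.^ n ℕ.≟ ι S
        size? : ∀ A B → Dec (∣ A ∣ ℕ.+ ∣ B ∣ ≡ K)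
        size? A B = ∣ A ∣ ℕ.+ ∣ B ∣ ℕ.≟ K
        X : ℕ → Subset n → Subset n → Carrier
        X i A B = if does (ι-sum? A B) then chop i f A * chop (K ℕ.∸ i) g B else 0#
        split-indicator : ∀ A B → (if does (ι-sum? A B ×-dec size? A B) then f A * g B else 0#)
                                    ≡ (if does (≡-dec _≟ᵇ_ B (S ─ A)) then (if does (A ⊆? S) then f A * g B else 0#) else 0#)
        split-indicator A B =
          ≡.trans (≡.cong (λ b → if b then f A * g B else 0#)
                          (does-⇔ (split⇔ι-+×size A B S) (ι-sum? A B ×-dec size? A B) (≡-dec _≟ᵇ_ B (S ─ A) ×-dec A ⊆? S)))
                  (≡.sym (if-∧ (does (≡-dec _≟ᵇ_ B (S ─ A))) (does (A ⊆? S)) (f A * g B)))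

theorem1 : ∀ {c ℓ : Level} (R : CommutativeRing c ℓ) →
    let open CommutativeRing R
        open SubsetConvolution R
    in (∀ x y → x * y ≈ 0# → (x ≈ 0#) ⊎ (y ≈ 0#)) →
       (n : ℕ) → 1 ≤ n →
       (ω ω̄ Ninv : Carrier) →
       ω * ω̄ ≈ 1# →
       pow ω (2 ℕ.^ n) ≈ 1# →
       (∀ t → 0 < t → t < 2 ℕ.^ n → ¬ (pow ω t ≈ 1#)) →
       natCast (2 ℕ.^ n) * Ninv ≈ 1# →
       (f g : Subset n → Carrier) →
       ∀ S → algorithm ω ω̄ Ninv f g S ≈ conv f g S
theorem1 R noZeroDivisors n _ ω ω̄ Ninv ω*ω̄≈1 ω^N≈1 ω-primitive N*Ninv≈1 f g S = begin
  algorithm ω ω̄ Ninv f g S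
    ≈⟨ algorithm≈layer ω ω̄ Ninv f g S ⟩
  layer ω ω̄ Ninv f g K S
    ≈⟨ IDFT-∑ {k = ℕ.suc K} ω Ninv (λ i m → f̂ (toℕ i) m * ĝ (K ℕ.∸ toℕ i) m) (ιF S) ⟩
  ∑[ i < ℕ.suc K ] IDFT ω Ninv (λ m → f̂ (toℕ i) m * ĝ (K ℕ.∸ toℕ i) m) (ιF S)
    ≈⟨ sum-cong-≋ {ℕ.suc K} (λ i → convolution-theorem (toVec (chop (toℕ i) f)) (toVec (chop (K ℕ.∸ toℕ i) g)) (ιF S)) ⟩
  ∑[ i < ℕ.suc K ] cyclicConv (toVec (chop (toℕ i) f)) (toVec (chop (K ℕ.∸ toℕ i) g)) (ιF S)
    ≈⟨ ∑-cyclicConv≈conv f g S ⟩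
  conv f g S ∎
  where
    open CommutativeRing R
    open SubsetConvolution R
    open import Algebra.Properties.Semiring.Sum semiring using (sum-cong-≋; sum-syntax)
    open import Relation.Binary.Reasoning.Setoid setoid
    open import Data.Fin.Subset using (∣_∣)
    open Fourier R using (IDFT-∑; cyclicConv)
    open Layers R
    instance
      2^n≢0 : ℕ.NonZero (2 ℕ.^ n)
      2^n≢0 = ℕₚ.m^n≢0 2 n
    open Fourier.PrimitiveRoot R noZeroDivisors (2 ℕ.^ n) ω ω̄ Ninv ω*ω̄≈1 ω^N≈1 ω-primitive N*Ninv≈1 using (convolution-theorem)
    K : ℕ
    K = ∣ S ∣
    f̂ ĝ : ℕ → Fin (2 ℕ.^ n) → Carrier
    f̂ i = DFT ω̄ (toVec (chop i f))
    ĝ i = DFT ω̄ (toVec (chop i g))
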